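{- Let $\alpha \in (0,1)$ and let $D$ be a multi-digraph without loops on $n$ vertices with minimum out-degree at least $\alpha n$ (counting multiplicities). Then $D$ contains a directed cycle with at most $4\alpha^{ -1}$ simple edges.
   Context: A multi-digraph may contain several copies of an edge $xy$. An edge $xy$ of $D$ is simple if $D$ contains exactly one copy of the edge from $x$ to $y$; otherwise it is a multiple edge.
   Formalization: The parameter α takes only rational values in (0,1) rather than real ones. -}

module Defs where

open import Data.Nat using (ℕ; zero; suc; _≟_)
open import Data.Fin using (Fin; zero; suc; toℕ; fromℕ<)
import Data.Nat as ℕ
open import Relation.Nullary using (yes; no)
open import Data.Vec using (tabulate; sum; count)
open import Data.Rational using (ℚ; 0ℚ; 1ℚ; _<_; _≤_; _*_)
open import Data.Integer using (+_)
import Data.Rational as ℚ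
open import Function.Definitions using (Injective)
open import Relation.Binary.PropositionalEquality using (_≡_)

-- A multi-digraph on the vertex set Fin n, given by edge multiplicities:
-- mult x y is the number of copies of the edge from x to y.
record MultiDigraph (n : ℕ) : Set where
  field
    mult : Fin n → Fin n → ℕ

open MultiDigraph public

Loopless : ∀ {n} → MultiDigraph n → Set
Loopless {n} D = (x : Fin n) → mult D x x ≡ 0

outDeg : ∀ {n} → MultiDigraph n → Fin n → ℕ
outDeg D x = sum (tabulate (mult D x))

cycSuc : ∀ {k} → Fin (suc k) → Fin (suc k)
cycSuc {k} i with toℕ i ℕ.<? k
... | yes p = suc (fromℕ< p)
... | no _  = zero

record DirectedCycle {n : ℕ} (D : MultiDigraph n) : Set where
  field
    len-1  : ℕ
    vertex : Fin (suc len-1) → Fin n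
    distinct : Injective _≡_ _≡_ vertex
    isEdge : (i : Fin (suc len-1)) → 1 ℕ.≤ mult D (vertex i) (vertex (cycSuc i))

open DirectedCycle public

simpleEdgeCount : ∀ {n} {D : MultiDigraph n} → DirectedCycle D → ℕ
simpleEdgeCount {D = D} C =
  count (λ m → m ≟ 1)
    (tabulate (λ i → mult D (vertex C i) (vertex C (cycSuc i))))

ℕ→ℚ : ℕ → ℚ
ℕ→ℚ m = + m ℚ./ 1

{-# OPTIONS --safe #-}
module Submission where

-- Write α = p / q and let r be the least integer with r p > q, so that 2 r p ≤ 4 q.  Call a vertex
-- set S dense if every vertex of S sends at least α |S| edges (with multiplicity) into S; the whole
-- vertex set is dense.  By induction on |S|, every nonempty dense S contains a cycle with at most
-- 2 r simple edges.  For u ∈ S let B a be the set of vertices reachable from u inside S by walks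
-- using at most a simple edges.  If some B a with a < r is dense, it is a proper subset of S and
-- induction applies.  Otherwise each B a has a vertex x with fewer than α |B a| edges into B a; the
-- remaining edges from x into S leave B a, so they are simple and end in B (a + 1).  Hence the
-- complement of the ball shrinks: (q + a p) |S ∖ B a| ≤ q |S ∖ B 0|, and for a = r this forces
-- 2 |B r| ≥ |S| + 2.  Double counting the pairs (v, w) with w ∈ B r (v) gives a vertex w whose
-- out-ball and in-ball have sizes adding up to at least |S| + 2, so they share a vertex v ≠ w.  The
-- walks w → v → w form a closed walk with at most 2 r simple edges, and a cycle is cut out of it.

open import Defs

module Arithmetic where

  open import Data.Nat
  open import Data.Nat.Properties
  open import Data.Nat.DivMod using (m≡m%n+[m/n]*n; m%n<n; m/n*n≤m)
  open import Data.Nat.Tactic.RingSolver using (solve-∀; solve)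
  open import Data.Empty using (⊥-elim)
  open import Data.List using (_∷_; [])
  open import Data.Product using (∃; _×_; _,_)
  open import Data.Sum using (_⊎_; inj₁; inj₂)
  open import Relation.Binary.PropositionalEquality
  open import Relation.Nullary using (yes; no)

  +-rotate : ∀ a b c → a + (b + c) ≡ c + a + b
  +-rotate = solve-∀

  m<n*o⇒0<o : ∀ {m n o} → m < n * o → 0 < o
  m<n*o⇒0<o {m} {n} {zero}  m<n*0 = ⊥-elim (n≮0 (subst (m <_) (*-zeroʳ n) m<n*0))
  m<n*o⇒0<o {o = suc _}     _     = s≤s z≤n

  next-multiple : ∀ p q → .{{NonZero p}} → ∃ λ r → q < r * p × r * p ≤ q + p
  next-multiple p q = suc (q / p) , above , within
    where
    above : q < suc (q / p) * p
    above = subst (_< p + q / p * p) (sym (m≡m%n+[m/n]*n q p)) (+-monoˡ-< (q / p * p) (m%n<n q p))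
    within : suc (q / p) * p ≤ q + p
    within = subst (_≤ q + p) (+-comm (q / p * p) p) (+-monoˡ-≤ p (m/n*n≤m q p))

  2r*p≤4q : ∀ {p q r} → r * p ≤ q + p → p < q → (r + r) * p ≤ 4 * q
  2r*p≤4q {p} {q} {r} rp≤q+p p<q = begin
    (r + r) * p         ≡⟨ *-distribʳ-+ p r r ⟩
    r * p + r * p       ≤⟨ +-mono-≤ rp≤2q rp≤2q ⟩
    (q + q) + (q + q)   ≡⟨ solve (q ∷ []) ⟩
    4 * q               ∎
    where
    open ≤-Reasoning
    rp≤2q : r * p ≤ q + q
    rp≤2q = ≤-trans rp≤q+p (+-monoʳ-≤ q (<⇒≤ p<q))

  ∃-non-increase-or-≤ : ∀ (f : ℕ → ℕ) j → (∃ λ K → f (suc K) ≤ f K) ⊎ j ≤ f j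
  ∃-non-increase-or-≤ f zero    = inj₂ z≤n
  ∃-non-increase-or-≤ f (suc j) with ∃-non-increase-or-≤ f j
  ... | inj₁ found = inj₁ found
  ... | inj₂ j≤fj with f (suc j) ≤? f j
  ...   | yes fsj≤fj = inj₁ (j , fsj≤fj)
  ...   | no  fsj≰fj = inj₂ (≤-trans (s≤s j≤fj) (≰⇒> fsj≰fj))

  bounded⇒∃-non-increase : ∀ (f : ℕ → ℕ) N → (∀ K → f K ≤ N) → ∃ λ K → f (suc K) ≤ f K
  bounded⇒∃-non-increase f N f≤N with ∃-non-increase-or-≤ f (suc N)
  ... | inj₁ found = found
  ... | inj₂ N<fN  = ⊥-elim (<⇒≱ (s≤s (f≤N (suc N))) N<fN)

  module _ (p q : ℕ) where

    -- cᵢ and oᵢ are the sizes of the complement of a ball and of the ball at two consecutive radii,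
    -- dS and dB the numbers of edges from one vertex of the ball into S and into the ball.
    complement-shrinks : ∀ {c₀ o₀ c₁ o₁ dS dB} → c₁ + o₁ ≡ c₀ + o₀ → p * (c₀ + o₀) ≤ q * dS →
                         dS + o₀ ≤ dB + o₁ → q * dB < p * o₀ → q * c₁ + p * c₀ < q * c₀
    complement-shrinks {c₀} {o₀} {c₁} {o₁} {dS} {dB} s≡ dense split sparse =
      +-cancelʳ-< _ (q * c₁ + p * c₀) (q * c₀) (begin-strict
        q * c₁ + p * c₀ + (p * o₀ + q * o₀ + q * o₁) ≡⟨ solve (p ∷ q ∷ c₀ ∷ o₀ ∷ c₁ ∷ o₁ ∷ []) ⟩
        q * (c₁ + o₁) + (p * (c₀ + o₀) + q * o₀)     ≡⟨ cong (λ s → q * s + (p * (c₀ + o₀) + q * o₀)) s≡ ⟩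
        q * (c₀ + o₀) + (p * (c₀ + o₀) + q * o₀)     <⟨ +-monoʳ-< (q * (c₀ + o₀)) growth ⟩
        q * (c₀ + o₀) + (p * o₀ + q * o₁)            ≡⟨ solve (p ∷ q ∷ c₀ ∷ o₀ ∷ o₁ ∷ []) ⟩
        q * c₀ + (p * o₀ + q * o₀ + q * o₁)          ∎)
      where
      open ≤-Reasoning
      growth : p * (c₀ + o₀) + q * o₀ < p * o₀ + q * o₁
      growth = begin-strict
        p * (c₀ + o₀) + q * o₀ ≤⟨ +-monoˡ-≤ (q * o₀) dense ⟩
        q * dS + q * o₀        ≡⟨ *-distribˡ-+ q dS o₀ ⟨
        q * (dS + o₀)          ≤⟨ *-monoʳ-≤ q split ⟩
        q * (dB + o₁)          ≡⟨ *-distribˡ-+ q dB o₁ ⟩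
        q * dB + q * o₁        <⟨ +-monoˡ-< (q * o₁) sparse ⟩
        p * o₀ + q * o₁        ∎

    growth-step : ∀ {b c⋆ c₀ c₁} → (q + b * p) * c₀ ≤ q * c⋆ → q * c₁ + p * c₀ ≤ q * c₀ →
                  c₁ ≤ c₀ → (q + suc b * p) * c₁ ≤ q * c⋆
    growth-step {b} {c⋆} {c₀} {c₁} invariant shrink c₁≤c₀ =
      ≤-trans (+-cancelʳ-≤ (p * c₀) _ _ (begin
        (q + (p + b * p)) * c₁ + p * c₀      ≡⟨ solve (p ∷ q ∷ b ∷ c₀ ∷ c₁ ∷ []) ⟩
        (q * c₁ + p * c₀) + (p + b * p) * c₁ ≤⟨ +-mono-≤ shrink (*-monoʳ-≤ (p + b * p) c₁≤c₀) ⟩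
        q * c₀ + (p + b * p) * c₀            ≡⟨ solve (p ∷ q ∷ b ∷ c₀ ∷ []) ⟩
        (q + b * p) * c₀ + p * c₀            ∎)) invariant
      where open ≤-Reasoning

  large-after-growth : ∀ {q P c c₀ o} → q < P → 2 ≤ c + o → c₀ < c + o → (q + P) * c ≤ q * c₀ →
                       c + o + 2 ≤ 2 * o
  large-after-growth {q} {P} {zero} {c₀} {o} _ 2≤o _ _ = begin
    o + 2 ≤⟨ +-monoʳ-≤ o 2≤o ⟩
    o + o ≡⟨ solve (o ∷ []) ⟩
    2 * o ∎
    where open ≤-Reasoning
  large-after-growth {q} {P} {suc c} {c₀} {o} q<P _ c₀<s shrunk = begin
    suc c + o + 2   ≡⟨ solve (c ∷ o ∷ []) ⟩
    o + (suc c + 2) ≤⟨ +-monoʳ-≤ o c+2≤o ⟩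
    o + o           ≡⟨ solve (o ∷ []) ⟩
    2 * o           ∎
    where
    open ≤-Reasoning
    2c<c₀ : 2 * suc c < c₀
    2c<c₀ = *-cancelˡ-< q _ _ (begin-strict
      q * (2 * suc c)   ≡⟨ solve (q ∷ c ∷ []) ⟩
      (q + q) * suc c   <⟨ *-monoˡ-< (suc c) (+-monoʳ-< q q<P) ⟩
      (q + P) * suc c   ≤⟨ shrunk ⟩
      q * c₀            ∎)
    c+2≤o : suc c + 2 ≤ o
    c+2≤o = +-cancelˡ-≤ (suc c) _ _ (begin
      suc c + (suc c + 2) ≡⟨ solve (c ∷ []) ⟩
      suc (2 * suc c) + 1 ≤⟨ +-monoˡ-≤ 1 2c<c₀ ⟩
      c₀ + 1              ≡⟨ +-comm c₀ 1 ⟩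
      suc c₀              ≤⟨ c₀<s ⟩
      suc c + o           ∎)

module FewSimpleEdges where

  open Arithmetic

  open import Data.Bool using (Bool; true; false; T; _∧_; _∨_)
  open import Data.Bool.Properties using (T-∧; T-∨; T?)
  open import Data.Empty using (⊥-elim)
  open import Data.Fin using (Fin; zero; suc; toℕ; fromℕ<)
  import Data.Fin.Properties as Fin
  open import Data.List using (List; []; _∷_; _++_; [_]; length)
  open import Data.List.Membership.Propositional using (_∈_; _∉_)
  open import Data.List.Membership.Propositional.Properties using (∈-∃++; ∈-++⁺ʳ)
  import Data.List.Membership.DecPropositional as DecMembership
  open import Data.List.Relation.Unary.Any using (here; there)
  import Data.List.Relation.Unary.All as All
  open import Data.List.Relation.Unary.All.Properties using (¬Any⇒All¬; ++⁻ˡ)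
  open import Data.List.Relation.Unary.Linked using (Linked; []; [-]; _∷_)
  open import Data.List.Relation.Unary.Unique.Propositional using (Unique; []; _∷_)
  open import Data.List.Relation.Unary.Unique.Propositional.Properties using (Unique[x∷xs]⇒x∉xs)
  open import Data.Nat
  open import Data.Nat.Induction using (<-wellFounded)
  open import Data.Nat.Properties
  open import Algebra.Properties.Semiring.Sum +-*-semiring
    using (sum; sum-cong-≗; ∑-distrib-+; ∑-comm; *-distribˡ-sum)
  open import Data.Product using (Σ; ∃; _×_; _,_; proj₁; proj₂)
  open import Data.Sum using (_⊎_; inj₁; inj₂)
  open import Data.Vec using (Vec; lookup; fromList; _∷ʳ_; tabulate; count)
  import Data.Vec as Vec
  import Data.Vec.Properties as Vec
  open import Function using (_∘_; Equivalence)
  open import Induction.WellFounded using (Acc; acc)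
  open import Relation.Binary.PropositionalEquality hiding ([_])
  open import Relation.Nullary using (¬_; Dec; yes; no; does)
  open import Relation.Nullary.Decidable
    using (⌊_⌋; ¬?; _×-dec_; decidable-stable; toWitness; fromWitness)

  sum-tabulate : ∀ {n} (f : Fin n → ℕ) → Vec.sum (tabulate f) ≡ sum f
  sum-tabulate {zero}  f = refl
  sum-tabulate {suc n} f = cong (f zero +_) (sum-tabulate (f ∘ suc))

  sum-const : ∀ n c → sum {n} (λ _ → c) ≡ n * c
  sum-const zero    c = refl
  sum-const (suc n) c = cong (c +_) (sum-const n c)

  sum≡0 : ∀ {n} {f : Fin n → ℕ} → (∀ i → f i ≡ 0) → sum f ≡ 0
  sum≡0 {zero}  f≡0 = refl
  sum≡0 {suc n} f≡0 = cong₂ _+_ (f≡0 zero) (sum≡0 (f≡0 ∘ suc))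

  term≤sum : ∀ {n} (f : Fin n → ℕ) i → f i ≤ sum f
  term≤sum f zero    = m≤m+n _ _
  term≤sum f (suc i) = ≤-trans (term≤sum (f ∘ suc) i) (m≤n+m _ _)

  sum-mono-≤ : ∀ {n} {f g : Fin n → ℕ} → (∀ i → f i ≤ g i) → sum f ≤ sum g
  sum-mono-≤ {zero}  f≤g = z≤n
  sum-mono-≤ {suc n} f≤g = +-mono-≤ (f≤g zero) (sum-mono-≤ (f≤g ∘ suc))

  sum-mono-≤-tight : ∀ {n} {f g : Fin n → ℕ} → (∀ i → f i ≤ g i) → sum g ≤ sum f →
                     ∀ i → g i ≤ f i
  sum-mono-≤-tight {f = f} {g} f≤g Σg≤Σf zero =
    +-cancelʳ-≤ _ _ _ (≤-trans (+-monoʳ-≤ (g zero) (sum-mono-≤ (f≤g ∘ suc))) Σg≤Σf)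
  sum-mono-≤-tight {f = f} {g} f≤g Σg≤Σf (suc i) =
    sum-mono-≤-tight (f≤g ∘ suc) (+-cancelˡ-≤ (f zero) _ _ (≤-trans (+-monoˡ-≤ _ (f≤g zero)) Σg≤Σf)) i

  two≤sum : ∀ {n} (f : Fin n → ℕ) {i j} → i ≢ j → 1 ≤ f i → 1 ≤ f j → 2 ≤ sum f
  two≤sum f {zero}  {zero}  i≢j _  _  = ⊥-elim (i≢j refl)
  two≤sum f {zero}  {suc j} _   fi fj = +-mono-≤ fi (≤-trans fj (term≤sum (f ∘ suc) j))
  two≤sum f {suc i} {zero}  _   fi fj =
    subst (2 ≤_) (+-comm (sum (f ∘ suc)) (f zero)) (+-mono-≤ (≤-trans fi (term≤sum (f ∘ suc) i)) fj)
  two≤sum f {suc i} {suc j} i≢j fi fj =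
    ≤-trans (two≤sum (f ∘ suc) (i≢j ∘ cong suc) fi fj) (m≤n+m _ _)

  sum-positive : ∀ {n} (f : Fin n → ℕ) → 1 ≤ sum f → ∃ λ i → 1 ≤ f i
  sum-positive {suc n} f 1≤Σf with f zero in f0≡
  ... | suc _ = zero , subst (1 ≤_) (sym f0≡) (s≤s z≤n)
  ... | zero  = let i , 1≤fi = sum-positive (f ∘ suc) 1≤Σf in suc i , 1≤fi

  sum>term⇒∃ : ∀ {n} (f : Fin n → ℕ) j → f j < sum f → ∃ λ i → i ≢ j × 1 ≤ f i
  sum>term⇒∃ f zero f0<Σf =
    let i , 1≤fi = sum-positive (f ∘ suc) (+-cancelˡ-< (f zero) 0 _ f0+0<Σf) in suc i , (λ ()) , 1≤fi
    where
    f0+0<Σf : f zero + 0 < f zero + sum (f ∘ suc)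
    f0+0<Σf = subst (_< f zero + sum (f ∘ suc)) (sym (+-identityʳ (f zero))) f0<Σf
  sum>term⇒∃ f (suc j) fj<Σf with f zero in f0≡
  ... | suc _ = zero , (λ ()) , subst (1 ≤_) (sym f0≡) (s≤s z≤n)
  ... | zero  = let i , i≢j , 1≤fi = sum>term⇒∃ (f ∘ suc) j fj<Σf in suc i , i≢j ∘ Fin.suc-injective , 1≤fi

  module _ {A : Set} where

    Unique-++-∷⁻ : ∀ (as : List A) {x bs} → Unique (as ++ x ∷ bs) → x ∉ as × Unique as
    Unique-++-∷⁻ []       _           = (λ ()) , []
    Unique-++-∷⁻ (a ∷ as) (a≢ ∷ uniq) with Unique-++-∷⁻ as uniq
    ... | x∉as , uniq-as = x∉a∷as , ++⁻ˡ as a≢ ∷ uniq-as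
      where
      x∉a∷as : _ ∉ a ∷ as
      x∉a∷as (here refl)  = All.lookup a≢ (∈-++⁺ʳ as (here refl)) refl
      x∉a∷as (there x∈as) = x∉as x∈as

    Linked-prefix : ∀ {R : A → A → Set} (as : List A) {x bs} →
                    Linked R (as ++ x ∷ bs) → Linked R (as ++ [ x ])
    Linked-prefix []            _        = [-]
    Linked-prefix (a ∷ [])      (r ∷ _)  = r ∷ [-]
    Linked-prefix (a ∷ a′ ∷ as) (r ∷ rs) = r ∷ Linked-prefix (a′ ∷ as) rs

    lookup-fromList-∈ : ∀ (ys : List A) j → lookup (fromList ys) j ∈ ys
    lookup-fromList-∈ (y ∷ ys) zero    = here refl
    lookup-fromList-∈ (y ∷ ys) (suc j) = there (lookup-fromList-∈ ys j)

    lookup-fromList-injective : ∀ {ys : List A} → Unique ys →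
                                ∀ i j → lookup (fromList ys) i ≡ lookup (fromList ys) j → i ≡ j
    lookup-fromList-injective {y ∷ ys} _          zero    zero    _  = refl
    lookup-fromList-injective {y ∷ ys} (y≢ ∷ _)   zero    (suc j) eq =
      ⊥-elim (All.lookup y≢ (lookup-fromList-∈ ys j) eq)
    lookup-fromList-injective {y ∷ ys} (y≢ ∷ _)   (suc i) zero    eq =
      ⊥-elim (All.lookup y≢ (lookup-fromList-∈ ys i) (sym eq))
    lookup-fromList-injective {y ∷ ys} (_ ∷ uniq) (suc i) (suc j) eq =
      cong suc (lookup-fromList-injective uniq i j eq)

    lookup-∷ʳ-init : ∀ {k} y (ys : Vec A k) i j → toℕ i ≡ toℕ j → lookup (ys ∷ʳ y) i ≡ lookup ys j
    lookup-∷ʳ-init y (_ Vec.∷ _)  zero    zero    _  = refl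
    lookup-∷ʳ-init y (_ Vec.∷ ys) (suc i) (suc j) eq = lookup-∷ʳ-init y ys i j (suc-injective eq)

    lookup-∷ʳ-last : ∀ {k} y (ys : Vec A k) i → toℕ i ≡ k → lookup (ys ∷ʳ y) i ≡ y
    lookup-∷ʳ-last y Vec.[]       zero    _  = refl
    lookup-∷ʳ-last y (_ Vec.∷ ys) (suc i) eq = lookup-∷ʳ-last y ys i (suc-injective eq)

    lookup-cycSuc : ∀ {k} y (ys : Vec A k) i → lookup (y Vec.∷ ys) (cycSuc i) ≡ lookup (ys ∷ʳ y) i
    lookup-cycSuc {k} y ys i with toℕ i <? k
    ... | yes i<k = sym (lookup-∷ʳ-init y ys i (fromℕ< i<k) (sym (Fin.toℕ-fromℕ< i<k)))
    ... | no  i≮k = sym (lookup-∷ʳ-last y ys i (≤-antisym (≤-pred (Fin.toℕ<n i)) (≮⇒≥ i≮k)))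

  -- Vertex sets as Boolean predicates

  𝟙 : Bool → ℕ
  𝟙 true  = 1
  𝟙 false = 0

  𝟙≤1 : ∀ b → 𝟙 b ≤ 1
  𝟙≤1 true  = s≤s z≤n
  𝟙≤1 false = z≤n

  𝟙-mono : ∀ {a b} → (T a → T b) → 𝟙 a ≤ 𝟙 b
  𝟙-mono {false}         _   = z≤n
  𝟙-mono {true}  {true}  _   = ≤-refl
  𝟙-mono {true}  {false} a⇒b = ⊥-elim (a⇒b _)

  1≤𝟙⇒T : ∀ {b} → 1 ≤ 𝟙 b → T b
  1≤𝟙⇒T {true} _ = _

  T⇒𝟙≡1 : ∀ {b} → T b → 𝟙 b ≡ 1
  T⇒𝟙≡1 {true} _ = refl

  ¬T⇒𝟙≡0 : ∀ {b} → ¬ T b → 𝟙 b ≡ 0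
  ¬T⇒𝟙≡0 {true}  ¬b = ⊥-elim (¬b _)
  ¬T⇒𝟙≡0 {false} _  = refl

  𝟙-inclusion-exclusion : ∀ {a b c} → (T a → T c) → (T b → T c) → 𝟙 a + 𝟙 b ≤ 𝟙 c + 𝟙 (a ∧ b)
  𝟙-inclusion-exclusion {false} {false} _   _   = z≤n
  𝟙-inclusion-exclusion {false} {true}  _   b⇒c = +-monoˡ-≤ 0 (𝟙-mono {true} b⇒c)
  𝟙-inclusion-exclusion {true}  {false} a⇒c _   = +-monoˡ-≤ 0 (𝟙-mono {true} a⇒c)
  𝟙-inclusion-exclusion {true}  {true}  a⇒c _   = +-monoˡ-≤ 1 (𝟙-mono {true} a⇒c)

  module _ {n : ℕ} where

    infix 4 _⊆_
    _⊆_ : (Fin n → Bool) → (Fin n → Bool) → Set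
    S ⊆ S′ = ∀ {w} → T (S w) → T (S′ w)

    ∣_∣ : (Fin n → Bool) → ℕ
    ∣ S ∣ = sum (𝟙 ∘ S)

    ∣S∣≤n : ∀ S → ∣ S ∣ ≤ n
    ∣S∣≤n S = subst (∣ S ∣ ≤_) (trans (sum-const n 1) (*-identityʳ n)) (sum-mono-≤ (𝟙≤1 ∘ S))

    ∣∣-mono : ∀ {S S′} → S ⊆ S′ → ∣ S ∣ ≤ ∣ S′ ∣
    ∣∣-mono S⊆S′ = sum-mono-≤ (λ w → 𝟙-mono (S⊆S′ {w}))

    ∈⇒1≤∣∣ : ∀ S {w} → T (S w) → 1 ≤ ∣ S ∣
    ∈⇒1≤∣∣ S {w} w∈S = ≤-trans (𝟙-mono {true} (λ _ → w∈S)) (term≤sum (𝟙 ∘ S) w)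

    ⊆-∣∣-tight : ∀ {S S′} → S ⊆ S′ → ∣ S′ ∣ ≤ ∣ S ∣ → S′ ⊆ S
    ⊆-∣∣-tight S⊆S′ ∣S′∣≤∣S∣ {w} w∈S′ = 1≤𝟙⇒T (≤-trans (𝟙-mono {true} (λ _ → w∈S′))
      (sum-mono-≤-tight (λ v → 𝟙-mono (S⊆S′ {v})) ∣S′∣≤∣S∣ w))

  -- Walks and cycle extraction

  module Walks {n : ℕ} (D : MultiDigraph n) where

    open DecMembership (Fin._≟_ {n}) using (_∈?_)

    Edge : Fin n → Fin n → Set
    Edge x y = 1 ≤ mult D x y

    simpleWeight : ℕ → ℕ
    simpleWeight m = 𝟙 (does (m ≟ 1))

    simpleCost : Fin n → Fin n → ℕ
    simpleCost x y = simpleWeight (mult D x y)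

    infixl 5 _▷_
    data Walk (u : Fin n) : Fin n → Set where
      []  : Walk u u
      _▷_ : ∀ {x y} → Walk u x → Edge x y → Walk u y

    cost : ∀ {u y} → Walk u y → ℕ
    cost []                = 0
    cost (_▷_ {x} {y} ω _) = cost ω + simpleCost x y

    infixr 5 _++ʷ_
    _++ʷ_ : ∀ {u v w} → Walk u v → Walk v w → Walk u w
    ω ++ʷ []       = ω
    ω ++ʷ (ω′ ▷ e) = (ω ++ʷ ω′) ▷ e

    cost-++ʷ : ∀ {u v w} (ω : Walk u v) (ω′ : Walk v w) → cost (ω ++ʷ ω′) ≡ cost ω + cost ω′
    cost-++ʷ ω []                 = sym (+-identityʳ (cost ω))
    cost-++ʷ ω (_▷_ {x} {y} ω′ _) =
      trans (cong (_+ simpleCost x y) (cost-++ʷ ω ω′)) (+-assoc (cost ω) (cost ω′) _)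

    pathCost : List (Fin n) → ℕ
    pathCost (x ∷ y ∷ ys) = simpleCost x y + pathCost (y ∷ ys)
    pathCost _            = 0

    pathCost-prefix : ∀ (as : List (Fin n)) {x} bs → pathCost (as ++ [ x ]) ≤ pathCost (as ++ x ∷ bs)
    pathCost-prefix []            bs = z≤n
    pathCost-prefix (a ∷ [])      bs = +-monoʳ-≤ _ z≤n
    pathCost-prefix (a ∷ a′ ∷ as) bs = +-monoʳ-≤ _ (pathCost-prefix (a′ ∷ as) bs)

    CheapCycle : ℕ → Set
    CheapCycle B = Σ (DirectedCycle D) (λ C → simpleEdgeCount C ≤ B)

    CheapCycle-weaken : ∀ {B B′} → B ≤ B′ → CheapCycle B → CheapCycle B′
    CheapCycle-weaken B≤B′ (C , #simple≤B) = C , ≤-trans #simple≤B B≤B′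

    edgeMults : ∀ y ys → Fin n → Vec ℕ (suc (length ys))
    edgeMults y ys z = tabulate (λ i → mult D (lookup (fromList (y ∷ ys)) i) (lookup (fromList ys ∷ʳ z) i))

    Linked⇒lookup-Edge : ∀ y ys z → Linked Edge (y ∷ ys ++ [ z ]) →
                         ∀ i → Edge (lookup (fromList (y ∷ ys)) i) (lookup (fromList ys ∷ʳ z) i)
    Linked⇒lookup-Edge y []        z (e ∷ _)  zero    = e
    Linked⇒lookup-Edge y (y′ ∷ ys) z (e ∷ _)  zero    = e
    Linked⇒lookup-Edge y (y′ ∷ ys) z (_ ∷ es) (suc i) = Linked⇒lookup-Edge y′ ys z es i

    count-∷ : ∀ {k} m (ms : Vec ℕ k) → count (_≟ 1) (m Vec.∷ ms) ≡ simpleWeight m + count (_≟ 1) ms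
    count-∷ m ms with does (m ≟ 1)
    ... | true  = refl
    ... | false = refl

    count-edgeMults : ∀ y ys z → count (_≟ 1) (edgeMults y ys z) ≡ pathCost (y ∷ ys ++ [ z ])
    count-edgeMults y []        z = count-∷ (mult D y z) Vec.[]
    count-edgeMults y (y′ ∷ ys) z =
      trans (count-∷ (mult D y y′) (edgeMults y′ ys z)) (cong (simpleCost y y′ +_) (count-edgeMults y′ ys z))

    cycleFromList : ∀ {B} x as → Unique (x ∷ as) → Linked Edge (x ∷ as ++ [ x ]) →
                    pathCost (x ∷ as ++ [ x ]) ≤ B → CheapCycle B
    cycleFromList {B} x as uniq linked cost≤B = C , subst (_≤ B) (sym #simple≡) cost≤B
      where
      vertex′ : Fin (suc (length as)) → Fin n
      vertex′ = lookup (fromList (x ∷ as))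
      next≡ : ∀ i → vertex′ (cycSuc i) ≡ lookup (fromList as ∷ʳ x) i
      next≡ = lookup-cycSuc x (fromList as)
      C : DirectedCycle D
      C = record
        { len-1    = length as
        ; vertex   = vertex′
        ; distinct = lookup-fromList-injective uniq _ _
        ; isEdge   = λ i → subst (Edge (vertex′ i)) (sym (next≡ i)) (Linked⇒lookup-Edge x as x linked i)
        }
      #simple≡ : simpleEdgeCount C ≡ pathCost (x ∷ as ++ [ x ])
      #simple≡ = trans (cong (count (_≟ 1)) (Vec.tabulate-cong (λ i → cong (mult D (vertex′ i)) (next≡ i))))
                       (count-edgeMults x as x)

    closeCycle : ∀ {B c x} P → Edge x c → Linked Edge (c ∷ P) → Unique (c ∷ P) → x ∈ c ∷ P →
                 simpleCost x c + pathCost (c ∷ P) ≤ B → CheapCycle B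
    closeCycle {x = x} P e linked uniq x∈ cost≤B with ∈-∃++ x∈
    ... | [] , bs , refl =
      cycleFromList x [] (All.[] ∷ []) (e ∷ [-]) (≤-trans (+-monoʳ-≤ _ z≤n) cost≤B)
    ... | a ∷ as , bs , refl with Unique-++-∷⁻ (a ∷ as) uniq
    ...   | x∉ , uniq-a∷as =
      cycleFromList x (a ∷ as) (¬Any⇒All¬ _ x∉ ∷ uniq-a∷as) (e ∷ Linked-prefix (a ∷ as) linked)
        (≤-trans (+-monoʳ-≤ (simpleCost x a) (pathCost-prefix (a ∷ as) bs)) cost≤B)

    -- Read ω backwards, pushing its vertices onto the path c ∷ P of distinct vertices; the first
    -- vertex already on the path closes a cycle, and one is found at the latest when ω reaches u ∈ P.
    unwind : ∀ {B u c} P (ω : Walk u c) → Linked Edge (c ∷ P) → Unique (c ∷ P) → u ∈ P →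
             pathCost (c ∷ P) + cost ω ≤ B → CheapCycle B
    unwind P [] _ uniq u∈P _ = ⊥-elim (Unique[x∷xs]⇒x∉xs uniq u∈P)
    unwind {B} {c = c} P (_▷_ {x} ω e) linked uniq u∈P cost≤B = step (x ∈? c ∷ P)
      where
      cost≤B′ : simpleCost x c + pathCost (c ∷ P) + cost ω ≤ B
      cost≤B′ = subst (_≤ B) (+-rotate (pathCost (c ∷ P)) (cost ω) (simpleCost x c)) cost≤B
      step : Dec (x ∈ c ∷ P) → CheapCycle B
      step (yes x∈) = closeCycle P e linked uniq x∈ (≤-trans (m≤m+n _ (cost ω)) cost≤B′)
      step (no  x∉) = unwind (c ∷ P) ω (e ∷ linked) (¬Any⇒All¬ _ x∉ ∷ uniq) (there u∈P) cost≤B′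

    closedWalk⇒CheapCycle : ∀ {u x} (ω : Walk u x) (e : Edge x u) → CheapCycle (cost (ω ▷ e))
    closedWalk⇒CheapCycle {u} {x} ω e with x Fin.≟ u
    ... | yes refl = closeCycle [] e [-] (All.[] ∷ []) (here refl)
                       (≤-trans (≤-reflexive (+-identityʳ _)) (m≤n+m _ (cost ω)))
    ... | no  x≢u  = unwind [ u ] ω (e ∷ [-]) ((x≢u All.∷ All.[]) ∷ All.[] ∷ []) (here refl)
                       (≤-reflexive (trans (cong (_+ cost ω) (+-identityʳ _)) (+-comm _ (cost ω))))

    roundTrip⇒CheapCycle : ∀ {u v} → u ≢ v → (ω : Walk u v) (ω′ : Walk v u) →
                           CheapCycle (cost ω + cost ω′)
    roundTrip⇒CheapCycle u≢v ω []       = ⊥-elim (u≢v refl)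
    roundTrip⇒CheapCycle u≢v ω (ω′ ▷ e) =
      CheapCycle-weaken (≤-reflexive (cost-++ʷ ω (ω′ ▷ e))) (closedWalk⇒CheapCycle (ω ++ʷ ω′) e)

  -- Balls of bounded simple-edge cost

  module Balls {n : ℕ} (D : MultiDigraph n) (S : Fin n → Bool) (u : Fin n) (r : ℕ) where

    open Walks D

    -- reach K a w: w is reached from u inside S by a walk of at most K edges, at most a of them simple.
    reach    : ℕ → ℕ → Fin n → Bool
    Extends  : ℕ → ℕ → Fin n → Fin n → Set
    extends? : ∀ K a x w → Dec (Extends K a x w)

    reach zero    a w = S w ∧ ⌊ w Fin.≟ u ⌋
    reach (suc K) a w = reach K a w ∨ (S w ∧ ⌊ Fin.any? (λ x → extends? K a x w) ⌋)

    Extends K a x w = Edge x w × simpleCost x w ≤ a × T (reach K (a ∸ simpleCost x w) x)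

    extends? K a x w =
      (1 ≤? mult D x w) ×-dec (simpleCost x w ≤? a) ×-dec T? (reach K (a ∸ simpleCost x w) x)

    reach-suc⁺ˡ : ∀ K {a w} → T (reach K a w) → T (reach (suc K) a w)
    reach-suc⁺ˡ K = Equivalence.from T-∨ ∘ inj₁

    reach-suc⁺ʳ : ∀ K {a w} x → T (S w) → Extends K a x w → T (reach (suc K) a w)
    reach-suc⁺ʳ K {a} {w} x w∈S ext = Equivalence.from T-∨ (inj₂ (Equivalence.from T-∧
      (w∈S , fromWitness {a? = Fin.any? λ y → extends? K a y w} (x , ext))))

    reach-suc⁻ : ∀ K {a w} → T (reach (suc K) a w) →
                 T (reach K a w) ⊎ (T (S w) × ∃ λ x → Extends K a x w)
    reach-suc⁻ K w∈ with Equivalence.to T-∨ w∈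
    ... | inj₁ w∈′ = inj₁ w∈′
    ... | inj₂ w∈′ with Equivalence.to T-∧ w∈′
    ...   | w∈S , ext = inj₂ (w∈S , toWitness ext)

    reach⊆S : ∀ K a → reach K a ⊆ S
    reach⊆S zero    a w∈ = proj₁ (Equivalence.to T-∧ w∈)
    reach⊆S (suc K) a w∈ with reach-suc⁻ K w∈
    ... | inj₁ w∈′       = reach⊆S K a w∈′
    ... | inj₂ (w∈S , _) = w∈S

    reach⇒centre∈S : ∀ K a {w} → T (reach K a w) → T (S u)
    reach⇒centre∈S zero    a w∈ with Equivalence.to T-∧ w∈
    ... | w∈S , w≡u = subst (T ∘ S) (toWitness w≡u) w∈S
    reach⇒centre∈S (suc K) a w∈ with reach-suc⁻ K w∈
    ... | inj₁ w∈′                  = reach⇒centre∈S K a w∈′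
    ... | inj₂ (_ , x , _ , _ , x∈) = reach⇒centre∈S K _ x∈

    centre∈reach : T (S u) → ∀ K a → T (reach K a u)
    centre∈reach u∈S zero    a = Equivalence.from T-∧ (u∈S , fromWitness refl)
    centre∈reach u∈S (suc K) a = reach-suc⁺ˡ K (centre∈reach u∈S K a)

    reach-mono : ∀ K {a a′} → a ≤ a′ → reach K a ⊆ reach K a′
    reach-mono zero    a≤a′ w∈ = w∈
    reach-mono (suc K) a≤a′ w∈ with reach-suc⁻ K w∈
    ... | inj₁ w∈′ = reach-suc⁺ˡ K (reach-mono K a≤a′ w∈′)
    ... | inj₂ (w∈S , x , e , c≤a , x∈) =
      reach-suc⁺ʳ K x w∈S (e , ≤-trans c≤a a≤a′ , reach-mono K (∸-monoˡ-≤ (simpleCost x _) a≤a′) x∈)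

    reach⇒Walk : ∀ K a {w} → T (reach K a w) → Σ (Walk u w) (λ ω → cost ω ≤ a)
    reach⇒Walk zero    a {w} w∈ with toWitness {a? = w Fin.≟ u} (proj₂ (Equivalence.to T-∧ w∈))
    ... | refl = [] , z≤n
    reach⇒Walk (suc K) a w∈ with reach-suc⁻ K w∈
    ... | inj₁ w∈′ = reach⇒Walk K a w∈′
    ... | inj₂ (_ , x , e , c≤a , x∈) with reach⇒Walk K _ x∈
    ...   | ω , cost≤ = ω ▷ e , subst (cost ω + simpleCost x _ ≤_) (m∸n+n≡m c≤a) (+-monoˡ-≤ _ cost≤)

    reachVolume : ℕ → ℕ
    reachVolume K = sum {suc r} (λ i → ∣ reach K (toℕ i) ∣)

    stabilisation : ∃ λ K → reachVolume (suc K) ≤ reachVolume K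
    stabilisation = bounded⇒∃-non-increase reachVolume (suc r * n) λ K →
      subst (reachVolume K ≤_) (sum-const (suc r) n) (sum-mono-≤ {suc r} (λ i → ∣S∣≤n (reach K (toℕ i))))

    stableDepth : ℕ
    stableDepth = proj₁ stabilisation

    ball : ℕ → Fin n → Bool
    ball = reach stableDepth

    reach-stable : ∀ {a} → a ≤ r → reach (suc stableDepth) a ⊆ ball a
    reach-stable {a} a≤r = ⊆-∣∣-tight (λ {w} → reach-suc⁺ˡ stableDepth {a} {w})
      (subst (λ b → ∣ reach (suc stableDepth) b ∣ ≤ ∣ ball b ∣) (Fin.toℕ-fromℕ< (s≤s a≤r))
        (sum-mono-≤-tight {suc r} (λ i → ∣∣-mono (λ {w} → reach-suc⁺ˡ stableDepth {toℕ i} {w}))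
          (proj₂ stabilisation) (fromℕ< (s≤s a≤r))))

    ball-closed : ∀ {a c x y} → simpleCost x y ≡ c → a + c ≤ r → T (ball a x) → T (S y) → Edge x y →
                  T (ball (a + c) y)
    ball-closed {a} {c} {x} refl a+c≤r x∈ y∈S e = reach-stable a+c≤r
      (reach-suc⁺ʳ stableDepth x y∈S (e , m≤n+m c a , subst (λ b → T (ball b x)) (sym (m+n∸n≡m a c)) x∈))

    ball⊆S : ∀ a → ball a ⊆ S
    ball⊆S = reach⊆S stableDepth

    ball-mono : ∀ {a a′} → a ≤ a′ → ball a ⊆ ball a′
    ball-mono = reach-mono stableDepth

    ball⇒centre∈S : ∀ a {w} → T (ball a w) → T (S u)
    ball⇒centre∈S = reach⇒centre∈S stableDepth

    centre∈ball : T (S u) → ∀ a → T (ball a u)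
    centre∈ball u∈S = centre∈reach u∈S stableDepth

    ball⇒Walk : ∀ a {w} → T (ball a w) → Σ (Walk u w) (λ ω → cost ω ≤ a)
    ball⇒Walk = reach⇒Walk stableDepth

    -- A multiple edge costs nothing, so an edge from ball b to a vertex of S outside it is simple,
    -- and its head lies in ball (suc b).
    ball-escape : ∀ {b x y} → suc b ≤ r → T (ball b x) → T (S y) → ¬ T (ball b y) →
                  mult D x y ≤ 𝟙 (ball (suc b) y)
    ball-escape {b} {x} {y} b<r x∈ y∈S y∉ with mult D x y in m≡
    ... | zero        = z≤n
    ... | suc zero    = ≤-reflexive (sym (T⇒𝟙≡1 (subst (λ a → T (ball a y)) (+-comm b 1)
                          (ball-closed (cong simpleWeight m≡) (≤-trans (≤-reflexive (+-comm b 1)) b<r)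
                             x∈ y∈S (subst (1 ≤_) (sym m≡) ≤-refl)))))
    ... | suc (suc _) = ⊥-elim (y∉ (subst (λ a → T (ball a y)) (+-identityʳ b)
                          (ball-closed {b} (cong simpleWeight m≡) (≤-trans (≤-reflexive (+-identityʳ b)) (<⇒≤ b<r))
                             x∈ y∈S (subst (1 ≤_) (sym m≡) (s≤s z≤n)))))

  -- Dense vertex sets

  module CycleSearch {n : ℕ} (D : MultiDigraph n) (loopless : Loopless D)
                     (p q r : ℕ) (q<rp : q < r * p) where

    open Walks D

    outDegInto : (Fin n → Bool) → Fin n → ℕ
    outDegInto S x = sum (λ y → 𝟙 (S y) * mult D x y)

    Dense : (Fin n → Bool) → Set
    Dense S = ∀ {x} → T (S x) → p * ∣ S ∣ ≤ q * outDegInto S x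

    dense? : ∀ S → Dense S ⊎ ∃ λ x → T (S x) × q * outDegInto S x < p * ∣ S ∣
    dense? S with Fin.any? (λ x → T? (S x) ×-dec q * outDegInto S x <? p * ∣ S ∣)
    ... | yes sparse-vertex = inj₂ sparse-vertex
    ... | no  none          = inj₁ λ {x} x∈S → ≮⇒≥ (λ sparse → none (x , x∈S , sparse))

    Dense⇒2≤∣S∣ : ∀ S {u} → T (S u) → Dense S → 2 ≤ ∣ S ∣
    Dense⇒2≤∣S∣ S {u} u∈S dense = out-neighbour (sum>term⇒∃ (λ y → 𝟙 (S y) * mult D u y) u loop<deg)
      where
      loop<deg : 𝟙 (S u) * mult D u u < outDegInto S u
      loop<deg = subst (_< outDegInto S u) (sym (trans (cong (𝟙 (S u) *_) (loopless u)) (*-zeroʳ (𝟙 (S u)))))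
        (*-cancelˡ-< q 0 _ (subst (_< q * outDegInto S u) (sym (*-zeroʳ q))
          (≤-trans (*-mono-≤ (m<n*o⇒0<o {n = r} q<rp) (∈⇒1≤∣∣ S u∈S)) (dense u∈S))))
      1≤𝟙*⇒T : ∀ b {m} → 1 ≤ 𝟙 b * m → T b
      1≤𝟙*⇒T true _ = _
      out-neighbour : (∃ λ y → y ≢ u × 1 ≤ 𝟙 (S y) * mult D u y) → 2 ≤ ∣ S ∣
      out-neighbour (y , y≢u , 1≤edges) =
        two≤sum (𝟙 ∘ S) y≢u (𝟙-mono {true} (λ _ → 1≤𝟙*⇒T (S y) 1≤edges)) (𝟙-mono {true} (λ _ → u∈S))

    SmallerDense⇒CheapCycle : (Fin n → Bool) → Set
    SmallerDense⇒CheapCycle S =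
      ∀ S′ → ∣ S′ ∣ < ∣ S ∣ → ∀ {v} → T (S′ v) → Dense S′ → CheapCycle (r + r)

    module Growth (S : Fin n → Bool) (dense : Dense S) (recurse : SmallerDense⇒CheapCycle S)
                  (u : Fin n) (u∈S : T (S u)) where

      open Balls D S u r

      o c : ℕ → ℕ
      o a = ∣ ball a ∣
      c a = ∣ S ∣ ∸ o a

      c+o≡∣S∣ : ∀ a → c a + o a ≡ ∣ S ∣
      c+o≡∣S∣ a = m∸n+n≡m (∣∣-mono {S = ball a} {S′ = S} (ball⊆S a))

      o-mono : ∀ b → o b ≤ o (suc b)
      o-mono b = ∣∣-mono {S = ball b} {S′ = ball (suc b)} (ball-mono (n≤1+n b))

      degree-split : ∀ {b x} → suc b ≤ r → T (ball b x) →
                     outDegInto S x + o b ≤ outDegInto (ball b) x + o (suc b)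
      degree-split {b} {x} b<r x∈ = begin
        outDegInto S x + o b                     ≡⟨ ∑-distrib-+ (λ y → 𝟙 (S y) * mult D x y) (𝟙 ∘ ball b) ⟨
        sum (λ y → 𝟙 (S y) * m y + 𝟙 (ball b y))  ≤⟨ sum-mono-≤ pointwise ⟩
        sum (λ y → 𝟙 (ball b y) * m y + 𝟙 (ball (suc b) y))
          ≡⟨ ∑-distrib-+ (λ y → 𝟙 (ball b y) * mult D x y) (𝟙 ∘ ball (suc b)) ⟩
        outDegInto (ball b) x + o (suc b)        ∎
        where
        open ≤-Reasoning
        m : Fin n → ℕ
        m = mult D x
        pointwise : ∀ y → 𝟙 (S y) * m y + 𝟙 (ball b y) ≤ 𝟙 (ball b y) * m y + 𝟙 (ball (suc b) y)
        pointwise y with T? (ball b y)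
        ... | yes y∈B rewrite T⇒𝟙≡1 (ball⊆S b y∈B) | T⇒𝟙≡1 y∈B | T⇒𝟙≡1 (ball-mono (n≤1+n b) y∈B) = ≤-refl
        ... | no  y∉B rewrite ¬T⇒𝟙≡0 y∉B with T? (S y)
        ...   | no  y∉S rewrite ¬T⇒𝟙≡0 y∉S = z≤n
        ...   | yes y∈S rewrite T⇒𝟙≡1 y∈S | +-identityʳ (m y) | +-identityʳ (m y) = ball-escape b<r x∈ y∈S y∉B

      growth : ∀ a → a ≤ r → CheapCycle (r + r) ⊎ (q + a * p) * c a ≤ q * c 0
      growth zero    _   = inj₂ (≤-reflexive (cong (_* c 0) (+-identityʳ q)))
      growth (suc b) b<r with growth b (<⇒≤ b<r)
      ... | inj₁ cycle     = inj₁ cycle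
      ... | inj₂ invariant with o b <? ∣ S ∣
      ...   | no  ball-full =
        inj₂ (subst (_≤ q * c 0) (sym (trans (cong ((q + suc b * p) *_) c≡0) (*-zeroʳ (q + suc b * p)))) z≤n)
        where
        c≡0 : c (suc b) ≡ 0
        c≡0 = m≤n⇒m∸n≡0 (≤-trans (≮⇒≥ ball-full) (o-mono b))
      ...   | yes ball-proper with dense? (ball b)
      ...     | inj₁ ball-dense = inj₁ (recurse (ball b) ball-proper (centre∈ball u∈S b) ball-dense)
      ...     | inj₂ (x , x∈B , sparse) =
        inj₂ (growth-step p q {b} invariant (<⇒≤ shrink) (∸-monoʳ-≤ ∣ S ∣ (o-mono b)))
        where
        shrink : q * c (suc b) + p * c b < q * c b
        shrink = complement-shrinks p q (trans (c+o≡∣S∣ (suc b)) (sym (c+o≡∣S∣ b)))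
          (subst (λ s → p * s ≤ q * outDegInto S x) (sym (c+o≡∣S∣ b)) (dense (ball⊆S b x∈B)))
          (degree-split b<r x∈B) sparse

      large-ball : CheapCycle (r + r) ⊎ ∣ S ∣ + 2 ≤ 2 * o r
      large-ball with growth r ≤-refl
      ... | inj₁ cycle  = inj₁ cycle
      ... | inj₂ shrunk = inj₂ (subst (λ s → s + 2 ≤ 2 * o r) (c+o≡∣S∣ r)
        (large-after-growth q<rp (subst (2 ≤_) (sym (c+o≡∣S∣ r)) (Dense⇒2≤∣S∣ S u∈S dense)) c₀<s shrunk))
        where
        c₀<s : c 0 < c r + o r
        c₀<s = subst (c 0 <_) (trans (c+o≡∣S∣ 0) (sym (c+o≡∣S∣ r)))
          (m<m+n (c 0) (∈⇒1≤∣∣ (ball 0) (centre∈ball u∈S 0)))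

    module DoubleCounting (S : Fin n → Bool) (dense : Dense S) (recurse : SmallerDense⇒CheapCycle S) where

      B : Fin n → Fin n → Bool
      B v = Balls.ball D S v r r

      Out In : Fin n → ℕ
      Out v = ∣ B v ∣
      In  w = sum (λ v → 𝟙 (B v w))

      AllBallsLarge : Set
      AllBallsLarge = ∀ {v} → T (S v) → ∣ S ∣ + 2 ≤ 2 * Out v

      B⊆S : ∀ v → B v ⊆ S
      B⊆S v = Balls.ball⊆S D S v r r

      B⇒centre∈S : ∀ {v w} → T (B v w) → T (S v)
      B⇒centre∈S {v} = Balls.ball⇒centre∈S D S v r r

      ∑Out≡∑In : sum (λ v → 2 * Out v) ≡ sum (λ w → 2 * In w)
      ∑Out≡∑In = begin
        sum (λ v → 2 * Out v)  ≡⟨ *-distribˡ-sum 2 Out ⟨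
        2 * sum Out            ≡⟨ cong (2 *_) (∑-comm (λ v w → 𝟙 (B v w))) ⟩
        2 * sum In             ≡⟨ *-distribˡ-sum 2 In ⟩
        sum (λ w → 2 * In w)   ∎
        where open ≡-Reasoning

      In-outside : ∀ {w} → ¬ T (S w) → In w ≡ 0
      In-outside w∉S = sum≡0 λ v → ¬T⇒𝟙≡0 (w∉S ∘ B⊆S v)

      all-balls-large : CheapCycle (r + r) ⊎ AllBallsLarge
      all-balls-large with Fin.any? (λ v → T? (S v) ×-dec ¬? (∣ S ∣ + 2 ≤? 2 * Out v))
      ... | yes (v , v∈S , small) with Growth.large-ball S dense recurse v v∈S
      ...   | inj₁ cycle = inj₁ cycle
      ...   | inj₂ large = ⊥-elim (small large)
      all-balls-large | no none =
        inj₂ λ {v} v∈S → decidable-stable (∣ S ∣ + 2 ≤? 2 * Out v) (λ small → none (v , v∈S , small))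

      popular-vertex : AllBallsLarge → ∀ {u} → T (S u) → ∃ λ w → T (S w) × ∣ S ∣ + 2 ≤ 2 * In w
      popular-vertex large {u} u∈S with Fin.any? (λ w → T? (S w) ×-dec (∣ S ∣ + 2 ≤? 2 * In w))
      ... | yes found = found
      ... | no  none  =
        ⊥-elim (none (u , u∈S , subst (_≤ 2 * In u) weighted-u (sum-mono-≤-tight In-small ∑S≤∑In u)))
        where
        weighted : Fin n → ℕ
        weighted w = 𝟙 (S w) * (∣ S ∣ + 2)
        weighted-u : weighted u ≡ ∣ S ∣ + 2
        weighted-u = trans (cong (_* (∣ S ∣ + 2)) (T⇒𝟙≡1 u∈S)) (*-identityˡ (∣ S ∣ + 2))
        In-small : ∀ w → 2 * In w ≤ weighted w
        In-small w with T? (S w)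
        ... | yes w∈S rewrite T⇒𝟙≡1 w∈S | *-identityˡ (∣ S ∣ + 2) = <⇒≤ (≰⇒> λ s+2≤ → none (w , w∈S , s+2≤))
        ... | no  w∉S rewrite In-outside w∉S | ¬T⇒𝟙≡0 w∉S = z≤n
        Out-large : ∀ v → weighted v ≤ 2 * Out v
        Out-large v with T? (S v)
        ... | yes v∈S rewrite T⇒𝟙≡1 v∈S | *-identityˡ (∣ S ∣ + 2) = large v∈S
        ... | no  v∉S rewrite ¬T⇒𝟙≡0 v∉S = z≤n
        ∑S≤∑In : sum weighted ≤ sum (λ w → 2 * In w)
        ∑S≤∑In = ≤-trans (sum-mono-≤ Out-large) (≤-reflexive ∑Out≡∑In)

      cycle-through-popular : AllBallsLarge → ∀ {w} → T (S w) → ∣ S ∣ + 2 ≤ 2 * In w → CheapCycle (r + r)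
      cycle-through-popular large {w} w∈S popular =
        round-trip (sum>term⇒∃ (λ v → 𝟙 (B w v ∧ B v w)) w (≤-trans (s≤s (𝟙≤1 (B w w ∧ B w w))) 2≤∣∩∣))
        where
        open ≤-Reasoning
        s+2≤Out+In : ∣ S ∣ + 2 ≤ Out w + In w
        s+2≤Out+In = *-cancelˡ-≤ 2 (begin
          2 * (∣ S ∣ + 2)            ≡⟨ cong (∣ S ∣ + 2 +_) (+-identityʳ (∣ S ∣ + 2)) ⟩
          (∣ S ∣ + 2) + (∣ S ∣ + 2)  ≤⟨ +-mono-≤ (large w∈S) popular ⟩
          2 * Out w + 2 * In w       ≡⟨ *-distribˡ-+ 2 (Out w) (In w) ⟨
          2 * (Out w + In w)         ∎)
        2≤∣∩∣ : 2 ≤ sum (λ v → 𝟙 (B w v ∧ B v w))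
        2≤∣∩∣ = +-cancelˡ-≤ ∣ S ∣ 2 _ (begin
          ∣ S ∣ + 2                                ≤⟨ s+2≤Out+In ⟩
          Out w + In w                             ≡⟨ ∑-distrib-+ (𝟙 ∘ B w) (λ v → 𝟙 (B v w)) ⟨
          sum (λ v → 𝟙 (B w v) + 𝟙 (B v w))
            ≤⟨ sum-mono-≤ (λ v → 𝟙-inclusion-exclusion {B w v} {B v w} {S v} (B⊆S w) B⇒centre∈S) ⟩
          sum (λ v → 𝟙 (S v) + 𝟙 (B w v ∧ B v w))  ≡⟨ ∑-distrib-+ (𝟙 ∘ S) (λ v → 𝟙 (B w v ∧ B v w)) ⟩
          ∣ S ∣ + sum (λ v → 𝟙 (B w v ∧ B v w))    ∎)
        round-trip : (∃ λ v → v ≢ w × 1 ≤ 𝟙 (B w v ∧ B v w)) → CheapCycle (r + r)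
        round-trip (v , v≢w , 1≤𝟙) with Equivalence.to T-∧ (1≤𝟙⇒T 1≤𝟙)
        ... | v∈Bw , w∈Bv with Balls.ball⇒Walk D S w r r v∈Bw | Balls.ball⇒Walk D S v r r w∈Bv
        ...   | ω , ω≤r | ω′ , ω′≤r =
          CheapCycle-weaken (+-mono-≤ ω≤r ω′≤r) (roundTrip⇒CheapCycle (v≢w ∘ sym) ω ω′)

      result : ∀ {u} → T (S u) → CheapCycle (r + r)
      result u∈S with all-balls-large
      ... | inj₁ cycle = cycle
      ... | inj₂ large with popular-vertex large u∈S
      ...   | w , w∈S , popular = cycle-through-popular large w∈S popular

    dense⇒CheapCycle : ∀ S {u} → T (S u) → Dense S → CheapCycle (r + r)
    dense⇒CheapCycle S = go S (<-wellFounded ∣ S ∣)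
      where
      go : ∀ S → Acc _<_ ∣ S ∣ → ∀ {u} → T (S u) → Dense S → CheapCycle (r + r)
      go S (acc smaller) u∈S dense =
        DoubleCounting.result S dense (λ S′ ∣S′∣<∣S∣ v∈S′ → go S′ (smaller ∣S′∣<∣S∣) v∈S′) u∈S

  cycle-with-few-simple-edges : ∀ {n} (D : MultiDigraph n) → Loopless D → Fin n →
    ∀ p q → .{{NonZero p}} → p < q → (∀ x → p * n ≤ q * outDeg D x) →
    Σ (DirectedCycle D) (λ C → simpleEdgeCount C * p ≤ 4 * q)
  cycle-with-few-simple-edges {n} D loopless u p q p<q minDeg with next-multiple p q
  ... | r , q<rp , rp≤q+p with CycleSearch.dense⇒CheapCycle D loopless p q r q<rp everything {u} _ dense
    where
    open CycleSearch D loopless p q r q<rp using (Dense; outDegInto)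
    everything : Fin n → Bool
    everything _ = true
    dense : Dense everything
    dense {x} _ = subst₂ (λ s d → p * s ≤ q * d) (sym ∣everything∣) (sym deg) (minDeg x)
      where
      ∣everything∣ : ∣ everything ∣ ≡ n
      ∣everything∣ = trans (sum-const n 1) (*-identityʳ n)
      deg : outDegInto everything x ≡ outDeg D x
      deg = trans (sum-cong-≗ (λ y → +-identityʳ (mult D x y))) (sym (sum-tabulate (mult D x)))
  ... | C , #simple≤2r = C , ≤-trans (*-monoˡ-≤ p #simple≤2r) (2r*p≤4q {r = r} rp≤q+p p<q)

open FewSimpleEdges using (cycle-with-few-simple-edges)

open import Data.Nat as ℕ using (ℕ; suc; NonZero)
import Data.Nat.Properties as ℕ
open import Data.Nat.Coprimality using (1-coprimeTo) renaming (sym to coprime-sym)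
open import Data.Fin as Fin using (Fin)
open import Data.Integer as ℤ using (+_; -[1+_])
import Data.Integer.Properties as ℤ
open import Data.Rational using (ℚ; mkℚ; 0ℚ; 1ℚ; _<_; _≤_; _*_; ↥_; ↧ₙ_; toℚᵘ; *<*)
import Data.Rational.Properties as ℚ
import Data.Rational.Unnormalised as ℚᵘ
import Data.Rational.Unnormalised.Properties as ℚᵘ
open import Data.Product using (Σ; _,_; proj₁; proj₂)
open import Relation.Binary.PropositionalEquality

-- Products in ℚ are normalised by a gcd, so inequalities between them are compared in ℚᵘ.

ℕ→ℚ-toℚᵘ : ∀ m → toℚᵘ (ℕ→ℚ m) ≡ ℚᵘ.mkℚᵘ (+ m) 0
ℕ→ℚ-toℚᵘ m = cong toℚᵘ (ℚ.normalize-coprime (coprime-sym (1-coprimeTo m)))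

α*m≤k⇒ : ∀ {α m k} → 0ℚ < α → α * ℕ→ℚ m ≤ ℕ→ℚ k → ℤ.∣ ↥ α ∣ ℕ.* m ℕ.≤ ↧ₙ α ℕ.* k
α*m≤k⇒ {mkℚ -[1+ _ ] _ _} (*<* ())
α*m≤k⇒ {α@(mkℚ (+ p) d _)} {m} {k} _ α*m≤k
  with ℚᵘ.≤-respˡ-≃ (ℚ.toℚᵘ-homo-* α (ℕ→ℚ m)) (ℚ.toℚᵘ-mono-≤ α*m≤k)
... | α*m≤k′ rewrite ℕ→ℚ-toℚᵘ m | ℕ→ℚ-toℚᵘ k with α*m≤k′
...   | ℚᵘ.*≤* pm≤kq = ℤ.drop‿+≤+ (subst₂ ℤ._≤_ lhs rhs pm≤kq)
  where
  lhs : (+ p ℤ.* + m) ℤ.* + 1 ≡ + (p ℕ.* m)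
  lhs = trans (ℤ.*-identityʳ _) (sym (ℤ.pos-* p m))
  rhs : + k ℤ.* + suc (d ℕ.* 1) ≡ + (suc d ℕ.* k)
  rhs = trans (sym (ℤ.pos-* k _))
              (cong +_ (trans (cong (λ t → k ℕ.* suc t) (ℕ.*-identityʳ d)) (ℕ.*-comm k (suc d))))

m*α≤k⇐ : ∀ {α m k} → 0ℚ < α → m ℕ.* ℤ.∣ ↥ α ∣ ℕ.≤ k ℕ.* ↧ₙ α → ℕ→ℚ m * α ≤ ℕ→ℚ k
m*α≤k⇐ {mkℚ -[1+ _ ] _ _} (*<* ())
m*α≤k⇐ {α@(mkℚ (+ p) d _)} {m} {k} _ mp≤kq =
  ℚ.toℚᵘ-cancel-≤ (ℚᵘ.≤-respˡ-≃ (ℚᵘ.≃-sym (ℚ.toℚᵘ-homo-* (ℕ→ℚ m) α))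
    (subst₂ ℚᵘ._≤_ (cong (ℚᵘ._* toℚᵘ α) (sym (ℕ→ℚ-toℚᵘ m))) (sym (ℕ→ℚ-toℚᵘ k))
      (ℚᵘ.*≤* (subst₂ ℤ._≤_ lhs rhs (ℤ.+≤+ mp≤kq)))))
  where
  lhs : + (m ℕ.* p) ≡ (+ m ℤ.* + p) ℤ.* + 1
  lhs = trans (ℤ.pos-* m p) (sym (ℤ.*-identityʳ _))
  rhs : + (k ℕ.* suc d) ≡ + k ℤ.* + (1 ℕ.* suc d)
  rhs = trans (cong (λ t → + (k ℕ.* t)) (sym (ℕ.*-identityˡ (suc d)))) (ℤ.pos-* k _)

numerator-nonZero : ∀ {α} → 0ℚ < α → NonZero ℤ.∣ ↥ α ∣
numerator-nonZero {mkℚ -[1+ _ ] _ _}  (*<* ())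
numerator-nonZero {mkℚ (+ 0) _ _}     (*<* (ℤ.+<+ ()))
numerator-nonZero {mkℚ (+ suc _) _ _} _ = _

numerator<denominator : ∀ {α} → 0ℚ < α → α < 1ℚ → ℤ.∣ ↥ α ∣ ℕ.< ↧ₙ α
numerator<denominator {mkℚ -[1+ _ ] _ _} (*<* ())
numerator<denominator {mkℚ (+ p) d _}    _ (*<* p*1<1*q) =
  ℤ.drop‿+<+ (subst₂ ℤ._<_ (ℤ.*-identityʳ (+ p)) (ℤ.*-identityˡ (+ suc d)) p*1<1*q)

lemma5p3 : (α : ℚ) → 0ℚ < α → α < 1ℚ → (n : ℕ) → NonZero n → (D : MultiDigraph n) → Loopless D
    → ((x : Fin n) → α * ℕ→ℚ n ≤ ℕ→ℚ (outDeg D x))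
    → Σ (DirectedCycle D) (λ C → ℕ→ℚ (simpleEdgeCount C) * α ≤ ℕ→ℚ 4)
lemma5p3 α 0<α α<1 (suc n) _ D loopless minDeg = C , m*α≤k⇐ {α} {simpleEdgeCount C} {4} 0<α #simple*p≤4q
  where
  found : Σ (DirectedCycle D) (λ C → simpleEdgeCount C ℕ.* ℤ.∣ ↥ α ∣ ℕ.≤ 4 ℕ.* ↧ₙ α)
  found = cycle-with-few-simple-edges D loopless Fin.zero ℤ.∣ ↥ α ∣ (↧ₙ α) {{numerator-nonZero 0<α}}
            (numerator<denominator 0<α α<1) (λ x → α*m≤k⇒ {α} {suc n} {outDeg D x} 0<α (minDeg x))
  C : DirectedCycle D
  C = proj₁ found
  #simple*p≤4q : simpleEdgeCount C ℕ.* ℤ.∣ ↥ α ∣ ℕ.≤ 4 ℕ.* ↧ₙ α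
  #simple*p≤4q = proj₂ found
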